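{- Let a finite group $\Gamma$ act on a finite set $X$. If $|\Gamma|\le k!$ then $D_\Gamma(X)\le k$.
   Context: For a group $\Gamma$ acting on a set $X$, write $g.x$ for the action and $\mathrm{Stab}_\Gamma(Y)=\{g\in\Gamma: g.y=y \text{ for all } y\in Y\}$. A labelling $\phi:X\to\{1,\dots,k\}$ is $k$-distinguishing if $\{g\in\Gamma:\phi(g.x)=\phi(x)\text{ for all }x\}=\mathrm{Stab}_\Gamma(X)$. The distinguishing number $D_\Gamma(X)$ is the minimum $k$ for which a $k$-distinguishing labelling exists. -}

module Defs where

open import Level using (Level; _⊔_)
open import Data.Nat using (ℕ)
open import Data.Fin using (Fin)
open import Algebra.Bundles using (Group)
open import Function.Bundles using (Inverse)
open import Relation.Binary.PropositionalEquality using (_≡_; setoid)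

HasOrder : ∀ {c ℓ} → Group c ℓ → ℕ → Set (c ⊔ ℓ)
HasOrder G n = Inverse (Group.setoid G) (setoid (Fin n))

-- A (left) action of the group G on the finite set X = Fin N.
-- (Every finite set is in bijection with some Fin N.)
record Action {c ℓ} (G : Group c ℓ) (N : ℕ) : Set (c ⊔ ℓ) where
  open Group G
  field
    act      : Carrier → Fin N → Fin N
    act-cong : ∀ {g h} → g ≈ h → ∀ x → act g x ≡ act h x
    act-id   : ∀ x → act ε x ≡ x
    act-comp : ∀ g h x → act (g ∙ h) x ≡ act g (act h x)

IsDistinguishing : ∀ {c ℓ} {G : Group c ℓ} {N k : ℕ} →
                   Action G N → (Fin N → Fin k) → Set c
IsDistinguishing {G = G} {N} A φ =
  ∀ (g : Group.Carrier G) →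
    ((∀ x → φ (act g x) ≡ φ x) → (∀ x → act g x ≡ x)) ×
    ((∀ x → act g x ≡ x) → (∀ x → φ (act g x) ≡ φ x))
  where
    open Action A
    open import Data.Product using (_×_)

DistNumber≤ : ∀ {c ℓ} {G : Group c ℓ} {N : ℕ} → Action G N → ℕ → Set c
DistNumber≤ A k = Σ ℕ λ j → j ≤ k × Σ (Fin _ → Fin j) λ φ → IsDistinguishing A φ
  where
    open import Data.Product using (Σ; _×_)
    open import Data.Nat using (_≤_)

{-# OPTIONS --safe #-}
-- Induct on k for the pointwise stabiliser S of a finite list of points, assuming |S| ≤ (k+1)!.
-- If every S-orbit has at most k+1 points, number the points of each orbit injectively.
-- Otherwise some orbit S·y has at least k+2 points, so by orbit–stabiliser the point stabiliser
-- S_y has fewer than k! elements (for k = 0 this case cannot occur).  Give y a label of its own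
-- and label for S_y by induction: a label-preserving g ∈ S must fix y, so g ∈ S_y, and then g
-- acts trivially.
module Submission where

open import Defs
open import Data.Nat using (ℕ; _≤_; _!; NonZero)
open import Algebra.Bundles using (Group)

open import Level using (_⊔_)
open import Data.Nat using (zero; suc; _*_)
open import Data.Nat.Properties using (≤-refl; ≤-trans; *-cancelˡ-≤; *-monoˡ-≤; n≤1+n; 1+n≰n)
open import Data.Fin using (Fin; zero; suc; _<_; _≟_; inject; fromℕ<; lift; combine; remQuot)
open import Data.Fin.Properties
  using (suc-injective; toℕ-injective; toℕ-inject; toℕ-fromℕ<; <-cmp; ¬∀⟶∃¬-smallest; ∀-cons;
         any?; lift-injective; injective⇒≤; combine-remQuot)
open import Data.List using (List; []; _∷_)
open import Data.List.Relation.Unary.All as All using (All; []; _∷_)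
open import Data.Product using (∃; Σ; _×_; _,_; proj₁; proj₂; uncurry)
open import Data.Sum as Sum using (_⊎_; inj₁; inj₂)
open import Data.Empty using (⊥-elim)
open import Function using (_∘_)
open import Function.Bundles using (Inverse; Injection)
open import Function.Definitions using (Injective)
open import Function.Properties.Inverse using (Inverse⇒Injection)
open import Relation.Binary.Definitions using (tri<; tri≈; tri>)
open import Relation.Binary.PropositionalEquality
  using (_≡_; _≢_; refl; sym; trans; cong; cong₂; subst; module ≡-Reasoning)
open import Relation.Nullary using (¬_; yes; no)
open import Relation.Nullary.Decidable using (decidable-stable; ¬?; map′; _×-dec_)
open import Relation.Unary using (Pred; Decidable; _⊆_; ∁)
import Algebra.Properties.Group as GroupProperties

module _ {p} {M : ℕ} (O : Pred (Fin M) p) where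

  InjectsInto : ℕ → Set p
  InjectsInto b = Σ ((z : Fin M) → O z → Fin b) λ f →
    ∀ {z z′} (o : O z) (o′ : O z′) → f z o ≡ f z′ o′ → z ≡ z′

  HasDistinct : ℕ → Set p
  HasDistinct a = Σ (Fin a → Fin M) λ h → Injective _≡_ _≡_ h × (∀ t → O (h t))

  Least : Fin M → Set p
  Least i = O i × (∀ j → j < i → ¬ O j)

injectsInto⊎hasDistinct : ∀ {p M} {O : Pred (Fin M) p} → Decidable O →
                          ∀ b → InjectsInto O b ⊎ HasDistinct O (suc b)
injectsInto⊎hasDistinct {M = zero} O? b = inj₁ ((λ ()) , λ { {()} })
injectsInto⊎hasDistinct {M = suc M} {O} O? b with O? zero
... | no ¬o₀ = Sum.map skip shift (injectsInto⊎hasDistinct (O? ∘ suc) b)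
  where
  skip : InjectsInto (O ∘ suc) b → InjectsInto O b
  skip (f , f-inj) = f′ , f′-inj
    where
    f′ : ∀ z → O z → Fin b
    f′ zero    o = ⊥-elim (¬o₀ o)
    f′ (suc z) o = f z o

    f′-inj : ∀ {z z′} (o : O z) (o′ : O z′) → f′ z o ≡ f′ z′ o′ → z ≡ z′
    f′-inj {zero}          o _  _  = ⊥-elim (¬o₀ o)
    f′-inj {suc _} {zero}  _ o′ _  = ⊥-elim (¬o₀ o′)
    f′-inj {suc _} {suc _} o o′ eq = cong suc (f-inj o o′ eq)

  shift : HasDistinct (O ∘ suc) (suc b) → HasDistinct O (suc b)
  shift (h , h-inj , h∈O) = suc ∘ h , h-inj ∘ suc-injective , h∈O
injectsInto⊎hasDistinct {M = suc M} O? zero | yes o₀ =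
  inj₂ ((λ _ → zero) , (λ { {zero} {zero} _ → refl }) , λ _ → o₀)
injectsInto⊎hasDistinct {M = suc M} {O} O? (suc b) | yes o₀ =
  Sum.map prepend extend (injectsInto⊎hasDistinct (O? ∘ suc) b)
  where
  prepend : InjectsInto (O ∘ suc) b → InjectsInto O (suc b)
  prepend (f , f-inj) = f′ , f′-inj
    where
    f′ : ∀ z → O z → Fin (suc b)
    f′ zero    _ = zero
    f′ (suc z) o = suc (f z o)

    f′-inj : ∀ {z z′} (o : O z) (o′ : O z′) → f′ z o ≡ f′ z′ o′ → z ≡ z′
    f′-inj {zero}  {zero}  _ _  _  = refl
    f′-inj {suc _} {suc _} o o′ eq = cong suc (f-inj o o′ (suc-injective eq))

  extend : HasDistinct (O ∘ suc) (suc b) → HasDistinct O (suc (suc b))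
  extend (h , h-inj , h∈O) = lift 1 h , lift-injective h h-inj 1 , h′∈O
    where
    h′∈O : ∀ t → O (lift 1 h t)
    h′∈O zero    = o₀
    h′∈O (suc t) = h∈O t

all⊎any : ∀ {p q m} {P : Pred (Fin m) p} {Q : Pred (Fin m) q} →
          (∀ i → P i ⊎ Q i) → (∀ i → P i) ⊎ ∃ Q
all⊎any {m = zero}  _   = inj₁ λ ()
all⊎any {m = suc m} P⊎Q with P⊎Q zero | all⊎any (P⊎Q ∘ suc)
... | inj₂ q₀ | _            = inj₂ (zero , q₀)
... | inj₁ p₀ | inj₁ ps      = inj₁ (∀-cons p₀ ps)
... | inj₁ _  | inj₂ (i , q) = inj₂ (suc i , q)

least : ∀ {p M} {O : Pred (Fin M) p} → Decidable O → ∃ O → ∃ (Least O)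
least {O = O} O? (i , oᵢ) with ¬∀⟶∃¬-smallest _ (∁ O) (¬? ∘ O?) (λ ∀¬O → ∀¬O i oᵢ)
... | j , ¬¬oⱼ , below = j , decidable-stable (O? j) ¬¬oⱼ , minimal
  where
  minimal : ∀ k → k < j → ¬ O k
  minimal k k<j = below (fromℕ< k<j) ∘ subst O (sym inject-fromℕ<)
    where
    inject-fromℕ< : inject (fromℕ< k<j) ≡ k
    inject-fromℕ< = toℕ-injective (trans (toℕ-inject (fromℕ< k<j)) (toℕ-fromℕ< k<j))

least-unique : ∀ {p q M} {O : Pred (Fin M) p} {O′ : Pred (Fin M) q} {i j} →
               O ⊆ O′ → O′ ⊆ O → Least O i → Least O′ j → i ≡ j
least-unique {i = i} {j} O⊆O′ O′⊆O (oᵢ , i-min) (o′ⱼ , j-min) with <-cmp i j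
... | tri< i<j _   _   = ⊥-elim (j-min i i<j (O⊆O′ oᵢ))
... | tri≈ _   i≡j _   = i≡j
... | tri> _   _   j<i = ⊥-elim (i-min j j<i (O′⊆O o′ⱼ))

module Labelling {c ℓ} {G : Group c ℓ} {n : ℕ} (order : HasOrder G n) {N : ℕ} (A : Action G N) where
  open Group G using (Carrier; _≈_; _∙_; ε; _⁻¹; inverseˡ)
  open Action A
  open Inverse order using (to; from; strictlyInverseʳ)
  open GroupProperties G using (∙-cancelˡ)
  open ≡-Reasoning

  act-inverseˡ : ∀ g x → act (g ⁻¹) (act g x) ≡ x
  act-inverseˡ g x = begin
    act (g ⁻¹) (act g x) ≡⟨ act-comp (g ⁻¹) g x ⟨
    act (g ⁻¹ ∙ g) x     ≡⟨ act-cong (inverseˡ g) x ⟩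
    act ε x              ≡⟨ act-id x ⟩
    x                    ∎

  act-injective : ∀ g → Injective _≡_ _≡_ (act g)
  act-injective g {x} {y} gx≡gy = begin
    x                    ≡⟨ act-inverseˡ g x ⟨
    act (g ⁻¹) (act g x) ≡⟨ cong (act (g ⁻¹)) gx≡gy ⟩
    act (g ⁻¹) (act g y) ≡⟨ act-inverseˡ g y ⟩
    y                    ∎

  -- Every subgroup met in the induction is the pointwise stabiliser of finitely many points,
  -- so it is represented by the list of those points.
  _∈Stab_ : Carrier → List (Fin N) → Set
  g ∈Stab ys = All (λ y → act g y ≡ y) ys

  ε∈Stab : ∀ ys → ε ∈Stab ys
  ε∈Stab = All.universal act-id

  ∙-∈Stab : ∀ {g h ys} → g ∈Stab ys → h ∈Stab ys → (g ∙ h) ∈Stab ys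
  ∙-∈Stab {g} {h} g∈ h∈ = All.zipWith fixes (g∈ , h∈)
    where
    fixes : ∀ {y} → act g y ≡ y × act h y ≡ y → act (g ∙ h) y ≡ y
    fixes {y} (gy≡y , hy≡y) = trans (act-comp g h y) (trans (cong (act g) hy≡y) gy≡y)

  ⁻¹-∈Stab : ∀ {g ys} → g ∈Stab ys → (g ⁻¹) ∈Stab ys
  ⁻¹-∈Stab {g} = All.map λ {y} gy≡y → trans (cong (act (g ⁻¹)) (sym gy≡y)) (act-inverseˡ g y)

  Orbit : List (Fin N) → Fin N → Fin N → Set c
  Orbit ys y z = ∃ λ g → g ∈Stab ys × act g y ≡ z

  orbit? : ∀ ys y → Decidable (Orbit ys y)
  orbit? ys y z = map′ (λ (i , w) → from i , w) enumerate
    (any? λ i → All.all? (λ x → act (from i) x ≟ x) ys ×-dec (act (from i) y ≟ z))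
    where
    enumerate : Orbit ys y z → ∃ λ i → from i ∈Stab ys × act (from i) y ≡ z
    enumerate (g , g∈ , gy≡z) = to g , All.map (trans (same _)) g∈ , trans (same y) gy≡z
      where
      same : ∀ x → act (from (to g)) x ≡ act g x
      same = act-cong (strictlyInverseʳ g)

  orbit-refl : ∀ {ys} y → Orbit ys y y
  orbit-refl {ys} y = ε , ε∈Stab ys , act-id y

  orbit-sym : ∀ {ys y z} → Orbit ys y z → Orbit ys z y
  orbit-sym {y = y} (g , g∈ , gy≡z) =
    g ⁻¹ , ⁻¹-∈Stab g∈ , trans (cong (act (g ⁻¹)) (sym gy≡z)) (act-inverseˡ g y)

  orbit-trans : ∀ {ys x y z} → Orbit ys x y → Orbit ys y z → Orbit ys x z
  orbit-trans {x = x} (g , g∈ , gx≡y) (h , h∈ , hy≡z) =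
    h ∙ g , ∙-∈Stab h∈ g∈ , trans (act-comp h g x) (trans (cong (act h) gx≡y) hy≡z)

  orbit-act : ∀ {g ys} y → g ∈Stab ys → Orbit ys y (act g y)
  orbit-act {g} _ g∈ = g , g∈ , refl

  leastInOrbit : ∀ ys y → ∃ (Least (Orbit ys y))
  leastInOrbit ys y = least (orbit? ys y) (y , orbit-refl y)

  rep : List (Fin N) → Fin N → Fin N
  rep ys y = proj₁ (leastInOrbit ys y)

  orbit-rep : ∀ ys y → Orbit ys (rep ys y) y
  orbit-rep ys y = orbit-sym (proj₁ (proj₂ (leastInOrbit ys y)))

  rep-cong : ∀ {ys y y′} → Orbit ys y y′ → rep ys y ≡ rep ys y′
  rep-cong {ys} {y} {y′} o = least-unique (orbit-trans (orbit-sym o)) (orbit-trans o)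
                                          (proj₂ (leastInOrbit ys y)) (proj₂ (leastInOrbit ys y′))

  Distinguishing : ∀ {b} → List (Fin N) → (Fin N → Fin b) → Set c
  Distinguishing ys φ = ∀ g → g ∈Stab ys → (∀ x → φ (act g x) ≡ φ x) → ∀ x → act g x ≡ x

  orbitwiseLabelling : ∀ {ys b} → (∀ y → InjectsInto (Orbit ys y) b) →
                       Σ (Fin N → Fin b) (Distinguishing ys)
  orbitwiseLabelling {ys} {b} inj = φ , distinguishes
    where
    -- Each orbit is numbered relative to its least point, which x and g·x share.
    φ : Fin N → Fin b
    φ x = proj₁ (inj (rep ys x)) x (orbit-rep ys x)

    φ-relativeTo : ∀ x {r} → rep ys x ≡ r → ∃ λ (o : Orbit ys r x) → φ x ≡ proj₁ (inj r) x o
    φ-relativeTo x refl = _ , refl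

    distinguishes : Distinguishing ys φ
    distinguishes g g∈ φ-preserved x with φ-relativeTo (act g x) (sym (rep-cong (orbit-act x g∈)))
    ... | o , φgx≡ = proj₂ (inj (rep ys x)) o (orbit-rep ys x) (trans (sym φgx≡) (φ-preserved x))

  pinnedLabelling : ∀ {ys b} y → Σ (Fin N → Fin b) (Distinguishing (y ∷ ys)) →
                    Σ (Fin N → Fin (suc b)) (Distinguishing ys)
  pinnedLabelling {ys} {b} y (χ , χ-distinguishes) = φ , distinguishes
    where
    φ : Fin N → Fin (suc b)
    φ x with x ≟ y
    ... | yes _ = zero
    ... | no  _ = suc (χ x)

    φ-pinned : φ y ≡ zero
    φ-pinned with y ≟ y
    ... | yes _   = refl
    ... | no  y≢y = ⊥-elim (y≢y refl)

    φ-zero : ∀ {x} → φ x ≡ zero → x ≡ y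
    φ-zero {x} with x ≟ y
    ... | yes x≡y = λ _ → x≡y
    ... | no  _   = λ ()

    φ-off : ∀ {x} → x ≢ y → φ x ≡ suc (χ x)
    φ-off {x} x≢y with x ≟ y
    ... | yes x≡y = ⊥-elim (x≢y x≡y)
    ... | no  _   = refl

    distinguishes : Distinguishing ys φ
    distinguishes g g∈ φ-preserved = χ-distinguishes g (gy≡y ∷ g∈) χ-preserved
      where
      gy≡y : act g y ≡ y
      gy≡y = φ-zero (trans (φ-preserved y) φ-pinned)

      χ-preserved : ∀ x → χ (act g x) ≡ χ x
      χ-preserved x with x ≟ y
      ... | yes refl = cong χ gy≡y
      ... | no  x≢y  = suc-injective (begin
        suc (χ (act g x)) ≡⟨ φ-off gx≢y ⟨
        φ (act g x)       ≡⟨ φ-preserved x ⟩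
        φ x               ≡⟨ φ-off x≢y ⟩
        suc (χ x)         ∎)
        where
        gx≢y : act g x ≢ y
        gx≢y gx≡y = x≢y (act-injective g (trans gx≡y (sym gy≡y)))

  AtMost : ∀ {p} → ℕ → Pred Carrier p → Set (c ⊔ ℓ ⊔ p)
  AtMost B P = ∀ {m} (f : Fin m → Carrier) → Injective _≡_ _≈_ f → (∀ i → P (f i)) → m ≤ B

  atMost-order : ∀ {p B} {P : Pred Carrier p} → n ≤ B → AtMost B P
  atMost-order n≤B f f-inj _ =
    ≤-trans (injective⇒≤ (f-inj ∘ Injection.injective (Inverse⇒Injection order))) n≤B

  orbit×stabiliser≤ : ∀ {ys y a m B} → AtMost B (_∈Stab ys) → HasDistinct (Orbit ys y) a →
                      (f : Fin m → Carrier) → Injective _≡_ _≈_ f → (∀ j → f j ∈Stab (y ∷ ys)) →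
                      a * m ≤ B
  orbit×stabiliser≤ {ys} {y} {a} {m} bound (h , h-inj , h∈orbit) f f-inj f∈ =
    bound pairs pairs-injective (λ _ → ∙-∈Stab (g∈ _) (All.tail (f∈ _)))
    where
    g : Fin a → Carrier
    g t = proj₁ (h∈orbit t)

    g∈ : ∀ t → g t ∈Stab ys
    g∈ t = proj₁ (proj₂ (h∈orbit t))

    pair : Fin a → Fin m → Carrier
    pair t j = g t ∙ f j

    pair-moves-y : ∀ t j → act (pair t j) y ≡ h t
    pair-moves-y t j = begin
      act (g t ∙ f j) y       ≡⟨ act-comp (g t) (f j) y ⟩
      act (g t) (act (f j) y) ≡⟨ cong (act (g t)) (All.head (f∈ j)) ⟩
      act (g t) y             ≡⟨ proj₂ (proj₂ (h∈orbit t)) ⟩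
      h t                     ∎

    pair-injective : ∀ {t j t′ j′} → pair t j ≈ pair t′ j′ → t ≡ t′ × j ≡ j′
    pair-injective {t} {j} {t′} {j′} eq
      with h-inj (trans (sym (pair-moves-y t j)) (trans (act-cong eq y) (pair-moves-y t′ j′)))
    ... | refl = refl , f-inj (∙-cancelˡ (g t) (f j) (f j′) eq)

    pairs : Fin (a * m) → Carrier
    pairs u = uncurry pair (remQuot {a} m u)

    pairs-injective : Injective _≡_ _≈_ pairs
    pairs-injective {u} {u′} eq with pair-injective eq
    ... | t≡t′ , j≡j′ = begin
      u                                  ≡⟨ combine-remQuot {a} m u ⟨
      uncurry combine (remQuot {a} m u)  ≡⟨ cong₂ combine t≡t′ j≡j′ ⟩
      uncurry combine (remQuot {a} m u′) ≡⟨ combine-remQuot {a} m u′ ⟩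
      u′                                 ∎

  noDistinctPair : ∀ {ys y} → AtMost 1 (_∈Stab ys) → ¬ HasDistinct (Orbit ys y) 2
  noDistinctPair {ys} {y} bound distinct =
    1+n≰n (orbit×stabiliser≤ {m = 1} bound distinct
             (λ _ → ε) (λ { {zero} {zero} _ → refl }) (λ _ → ε∈Stab (y ∷ ys)))

  stabiliser-shrinks : ∀ {ys y k} → AtMost (suc (suc k) !) (_∈Stab ys) →
                       HasDistinct (Orbit ys y) (suc (suc (suc k))) →
                       AtMost (suc k !) (_∈Stab (y ∷ ys))
  stabiliser-shrinks {k = k} bound distinct {m} f f-inj f∈ = *-cancelˡ-≤ (suc (suc k))
    (≤-trans (*-monoˡ-≤ m (n≤1+n (suc (suc k)))) (orbit×stabiliser≤ bound distinct f f-inj f∈))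

  distinguishingLabelling : ∀ k ys → AtMost (suc k !) (_∈Stab ys) →
                            Σ (Fin N → Fin (suc k)) (Distinguishing ys)
  distinguishingLabelling k ys bound
    with all⊎any (λ y → injectsInto⊎hasDistinct (orbit? ys y) (suc k))
  ... | inj₁ small = orbitwiseLabelling small
  distinguishingLabelling zero    ys bound | inj₂ (y , large) = ⊥-elim (noDistinctPair bound large)
  distinguishingLabelling (suc k) ys bound | inj₂ (y , large) =
    pinnedLabelling y (distinguishingLabelling k (y ∷ ys) (stabiliser-shrinks bound large))

corollary2p12 : ∀ {c ℓ} (Γ : Group c ℓ) (n : ℕ) → HasOrder Γ n →
    (N : ℕ) (A : Action Γ N) (k : ℕ) → .{{_ : NonZero k}} →
    n ≤ k ! → DistNumber≤ A k
corollary2p12 Γ n order N A (suc k) n≤k! =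
  let open Labelling order A
      φ , distinguishes = distinguishingLabelling k [] (atMost-order {P = _∈Stab []} n≤k!)
  in suc k , ≤-refl , φ , λ g → distinguishes g [] , λ g-fixes x → cong φ (g-fixes x)
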